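{- For every positive integer $k$, there is a palindromic Gallai-Schur $2k$-coloring of $[1,5^k-1]$ and a palindromic Gallai-Schur $(2k+1)$-coloring of $[1,2\cdot 5^k-1]$.
   Context: $[1,n]=\{1,\dots,n\}$. An $r$-coloring of $[1,n]$ is a function $\chi:[1,n]\to\{1,\dots,r\}$. Under $\chi$, a Gallai-Schur triple is a triple $(x,y,z)$ with $x,y,z\in[1,n]$, $x\leq y$, $x+y=z$, and either $\chi(x)=\chi(y)=\chi(z)$ or $\chi(x),\chi(y),\chi(z)$ pairwise distinct. $\chi$ is a Gallai-Schur coloring if it has no Gallai-Schur triple, and palindromic if $\chi(i)=\chi(n+1-i)$ for all $i\in[1,n]$. -}

module Defs where

open import Data.Nat using (ℕ; suc; _+_; _*_; _∸_; _^_; _≤_)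
open import Data.Fin using (Fin)
open import Data.Product using (_×_)
open import Data.Sum using (_⊎_)
open import Relation.Binary.PropositionalEquality using (_≡_; _≢_)
open import Relation.Nullary using (¬_)

-- An r-coloring of [1,n]: a map assigning to every natural number a colour in
-- Fin r (colours 1..r are represented by Fin r); only its values on [1,n] matter.
Coloring : ℕ → Set
Coloring r = ℕ → Fin r

InRange : ℕ → ℕ → Set
InRange n x = (1 ≤ x) × (x ≤ n)

GallaiSchurTriple : {r : ℕ} → ℕ → Coloring r → ℕ → ℕ → ℕ → Set
GallaiSchurTriple n χ x y z =
  InRange n x × InRange n y × InRange n z × x ≤ y × x + y ≡ z ×
  ((χ x ≡ χ y × χ y ≡ χ z) ⊎ (χ x ≢ χ y × χ y ≢ χ z × χ x ≢ χ z))

IsGallaiSchur : {r : ℕ} → ℕ → Coloring r → Set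
IsGallaiSchur n χ = ∀ x y z → ¬ GallaiSchurTriple n χ x y z

IsPalindromic : {r : ℕ} → ℕ → Coloring r → Set
IsPalindromic n χ = ∀ i → InRange n i → χ i ≡ χ (suc n ∸ i)

-- A palindromic Gallai-Schur colouring χ of [1,n] with r colours blows up to one of [1,5n+4]
-- with r + 2 colours: 5q keeps the colour χ(q), residues ±1 mod 5 get a new colour A and
-- residues ±2 a new colour B.  Since {±1} and {±2} are sum-free mod 5, a triple coloured from
-- {A,B} alone is neither monochromatic nor (with only two colours) rainbow; a triple with exactly
-- one multiple of 5 has its other two terms in one class ±ρ, so exactly two of its colours agree;
-- a triple of multiples of 5 is 5 times a triple of χ.  The pattern is invariant under ρ ↦ -ρ,
-- which keeps the colouring palindromic.  Iterating from [1,4] with 2 colours and from [1,1] with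
-- 1 colour gives the two families.

module Submission where

open import Defs
open import Data.Nat using (ℕ; zero; suc; _+_; _*_; _∸_; _^_; _≤_; _<_; s≤s; _%_; _/_; NonZero; >-nonZero)
open import Data.Nat.Properties using (*-identityʳ; *-suc; +-comm; m*n≢0; m^n≢0; n≤1+n; m+[n∸m]≡n; ≤-pred; m+n∸m≡n; +-suc; *-comm; *-assoc; ≤-trans)
open import Data.Nat.DivMod using (m%n<n; %-distribˡ-+; m*n/n≡m; /-monoˡ-≤; +-distrib-/-∣ˡ; m≥n⇒m/n>0; m<n*o⇒m/o<n)
open import Data.Nat.Divisibility using (_∣_; m%n≡0⇒n∣m; n∣m⇒m%n≡0; ∣⇒≤; ∣m∣n⇒∣m+n; n∣m*n)
open import Data.Fin using (Fin; zero; suc; _↑ʳ_)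
open import Data.Fin.Properties using (↑ʳ-injective)
open import Data.Product using (_×_; Σ; _,_; proj₁; proj₂)
open import Data.Empty using (⊥-elim)
open import Data.Sum using (_⊎_; inj₁; inj₂)
open import Function using (_∘_; const)
open import Relation.Nullary using (¬_)
open import Relation.Binary.PropositionalEquality

MonoOrRainbow : {r : ℕ} → Fin r → Fin r → Fin r → Set
MonoOrRainbow a b c = (a ≡ b × b ≡ c) ⊎ (a ≢ b × b ≢ c × a ≢ c)

module _ {r : ℕ} {a b c : Fin r} where

  a≡b≢c⇒¬MonoOrRainbow : a ≡ b → c ≢ a → ¬ MonoOrRainbow a b c
  a≡b≢c⇒¬MonoOrRainbow a≡b c≢a (inj₁ (_ , b≡c))      = c≢a (sym (trans a≡b b≡c))
  a≡b≢c⇒¬MonoOrRainbow a≡b c≢a (inj₂ (a≢b , _ , _)) = a≢b a≡b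

  b≡c≢a⇒¬MonoOrRainbow : b ≡ c → a ≢ b → ¬ MonoOrRainbow a b c
  b≡c≢a⇒¬MonoOrRainbow b≡c a≢b (inj₁ (a≡b , _))      = a≢b a≡b
  b≡c≢a⇒¬MonoOrRainbow b≡c a≢b (inj₂ (_ , b≢c , _)) = b≢c b≡c

  a≡c≢b⇒¬MonoOrRainbow : a ≡ c → b ≢ a → ¬ MonoOrRainbow a b c
  a≡c≢b⇒¬MonoOrRainbow a≡c b≢a (inj₁ (a≡b , _))      = b≢a (sym a≡b)
  a≡c≢b⇒¬MonoOrRainbow a≡c b≢a (inj₂ (_ , _ , a≢c)) = a≢c a≡c

MonoOrRainbow-injective : {r s : ℕ} {f : Fin r → Fin s} → (∀ {a b} → f a ≡ f b → a ≡ b) →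
                          ∀ {a b c} → MonoOrRainbow (f a) (f b) (f c) → MonoOrRainbow a b c
MonoOrRainbow-injective f-inj (inj₁ (fa≡fb , fb≡fc)) = inj₁ (f-inj fa≡fb , f-inj fb≡fc)
MonoOrRainbow-injective {f = f} f-inj (inj₂ (fa≢fb , fb≢fc , fa≢fc)) =
  inj₂ (fa≢fb ∘ cong f , fb≢fc ∘ cong f , fa≢fc ∘ cong f)

IsGallaiSchur-injective : {r s : ℕ} {f : Fin r → Fin s} → (∀ {a b} → f a ≡ f b → a ≡ b) →
                          ∀ {n χ} → IsGallaiSchur n χ → IsGallaiSchur n (f ∘ χ)
IsGallaiSchur-injective f-inj gs x y z (x∈ , y∈ , z∈ , x≤y , x+y≡z , mr) =
  gs x y z (x∈ , y∈ , z∈ , x≤y , x+y≡z , MonoOrRainbow-injective f-inj mr)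

PalindromicGallaiSchur : ℕ → ℕ → Set
PalindromicGallaiSchur r n = Σ (Coloring r) λ χ → IsGallaiSchur n χ × IsPalindromic n χ

∣⇒/-inRange : ∀ {d n x} → suc d ∣ x → InRange (d + n * suc d) x → InRange n (x / suc d)
∣⇒/-inRange {x = x} d∣x (1≤x , x≤) = m≥n⇒m/n>0 (∣⇒≤ {{>-nonZero 1≤x}} d∣x) , ≤-pred (m<n*o⇒m/o<n (s≤s x≤))

module BlowUp {r : ℕ} where

  A B : Fin (2 + r)
  A = zero
  B = suc zero

  Fresh : Fin (2 + r) → Set
  Fresh c = c ≢ A × c ≢ B

  colourByResidue : ℕ → Fin (2 + r) → Fin (2 + r)
  colourByResidue 0 c = c
  colourByResidue 1 _ = A
  colourByResidue 2 _ = B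
  colourByResidue 3 _ = B
  colourByResidue _ _ = A

  colourByResidue-¬MonoOrRainbow :
    ∀ ρ σ τ → ρ < 5 → σ < 5 → τ ≡ (ρ + σ) % 5 → ∀ {cx cy cz} →
    (ρ ≡ 0 → Fresh cx) → (σ ≡ 0 → Fresh cy) → (τ ≡ 0 → Fresh cz) →
    (ρ ≡ 0 → σ ≡ 0 → ¬ MonoOrRainbow cx cy cz) →
    ¬ MonoOrRainbow (colourByResidue ρ cx) (colourByResidue σ cy) (colourByResidue τ cz)
  colourByResidue-¬MonoOrRainbow 0 0 _ _ _ refl _  _  _  inner = inner refl refl
  colourByResidue-¬MonoOrRainbow 0 1 _ _ _ refl fx _  _  _ = b≡c≢a⇒¬MonoOrRainbow refl (proj₁ (fx refl))
  colourByResidue-¬MonoOrRainbow 0 2 _ _ _ refl fx _  _  _ = b≡c≢a⇒¬MonoOrRainbow refl (proj₂ (fx refl))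
  colourByResidue-¬MonoOrRainbow 0 3 _ _ _ refl fx _  _  _ = b≡c≢a⇒¬MonoOrRainbow refl (proj₂ (fx refl))
  colourByResidue-¬MonoOrRainbow 0 4 _ _ _ refl fx _  _  _ = b≡c≢a⇒¬MonoOrRainbow refl (proj₁ (fx refl))
  colourByResidue-¬MonoOrRainbow 1 0 _ _ _ refl _  fy _  _ = a≡c≢b⇒¬MonoOrRainbow refl (proj₁ (fy refl))
  colourByResidue-¬MonoOrRainbow 1 1 _ _ _ refl _  _  _  _ = a≡b≢c⇒¬MonoOrRainbow refl λ ()
  colourByResidue-¬MonoOrRainbow 1 2 _ _ _ refl _  _  _  _ = b≡c≢a⇒¬MonoOrRainbow refl λ ()
  colourByResidue-¬MonoOrRainbow 1 3 _ _ _ refl _  _  _  _ = a≡c≢b⇒¬MonoOrRainbow refl λ ()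
  colourByResidue-¬MonoOrRainbow 1 4 _ _ _ refl _  _  fz _ = a≡b≢c⇒¬MonoOrRainbow refl (proj₁ (fz refl))
  colourByResidue-¬MonoOrRainbow 2 0 _ _ _ refl _  fy _  _ = a≡c≢b⇒¬MonoOrRainbow refl (proj₂ (fy refl))
  colourByResidue-¬MonoOrRainbow 2 1 _ _ _ refl _  _  _  _ = a≡c≢b⇒¬MonoOrRainbow refl λ ()
  colourByResidue-¬MonoOrRainbow 2 2 _ _ _ refl _  _  _  _ = a≡b≢c⇒¬MonoOrRainbow refl λ ()
  colourByResidue-¬MonoOrRainbow 2 3 _ _ _ refl _  _  fz _ = a≡b≢c⇒¬MonoOrRainbow refl (proj₂ (fz refl))
  colourByResidue-¬MonoOrRainbow 2 4 _ _ _ refl _  _  _  _ = b≡c≢a⇒¬MonoOrRainbow refl λ ()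
  colourByResidue-¬MonoOrRainbow 3 0 _ _ _ refl _  fy _  _ = a≡c≢b⇒¬MonoOrRainbow refl (proj₂ (fy refl))
  colourByResidue-¬MonoOrRainbow 3 1 _ _ _ refl _  _  _  _ = b≡c≢a⇒¬MonoOrRainbow refl λ ()
  colourByResidue-¬MonoOrRainbow 3 2 _ _ _ refl _  _  fz _ = a≡b≢c⇒¬MonoOrRainbow refl (proj₂ (fz refl))
  colourByResidue-¬MonoOrRainbow 3 3 _ _ _ refl _  _  _  _ = a≡b≢c⇒¬MonoOrRainbow refl λ ()
  colourByResidue-¬MonoOrRainbow 3 4 _ _ _ refl _  _  _  _ = a≡c≢b⇒¬MonoOrRainbow refl λ ()
  colourByResidue-¬MonoOrRainbow 4 0 _ _ _ refl _  fy _  _ = a≡c≢b⇒¬MonoOrRainbow refl (proj₁ (fy refl))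
  colourByResidue-¬MonoOrRainbow 4 1 _ _ _ refl _  _  fz _ = a≡b≢c⇒¬MonoOrRainbow refl (proj₁ (fz refl))
  colourByResidue-¬MonoOrRainbow 4 2 _ _ _ refl _  _  _  _ = a≡c≢b⇒¬MonoOrRainbow refl λ ()
  colourByResidue-¬MonoOrRainbow 4 3 _ _ _ refl _  _  _  _ = b≡c≢a⇒¬MonoOrRainbow refl λ ()
  colourByResidue-¬MonoOrRainbow 4 4 _ _ _ refl _  _  _  _ = a≡b≢c⇒¬MonoOrRainbow refl λ ()
  colourByResidue-¬MonoOrRainbow (suc (suc (suc (suc (suc _))))) _ _ (s≤s (s≤s (s≤s (s≤s (s≤s ()))))) _ _ _ _ _ _
  colourByResidue-¬MonoOrRainbow _ (suc (suc (suc (suc (suc _))))) _ _ (s≤s (s≤s (s≤s (s≤s (s≤s ()))))) _ _ _ _ _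

  colourByResidue-mirror : ∀ ρ σ → ρ < 5 → σ < 5 → (ρ + σ) % 5 ≡ 0 → ∀ {c d} →
                           (ρ ≡ 0 → c ≡ d) → colourByResidue ρ c ≡ colourByResidue σ d
  colourByResidue-mirror 0 0 _ _ _  c≡d = c≡d refl
  colourByResidue-mirror 0 1 _ _ () _
  colourByResidue-mirror 0 2 _ _ () _
  colourByResidue-mirror 0 3 _ _ () _
  colourByResidue-mirror 0 4 _ _ () _
  colourByResidue-mirror 1 0 _ _ () _
  colourByResidue-mirror 1 1 _ _ () _
  colourByResidue-mirror 1 2 _ _ () _
  colourByResidue-mirror 1 3 _ _ () _
  colourByResidue-mirror 1 4 _ _ _  _ = refl
  colourByResidue-mirror 2 0 _ _ () _
  colourByResidue-mirror 2 1 _ _ () _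
  colourByResidue-mirror 2 2 _ _ () _
  colourByResidue-mirror 2 3 _ _ _  _ = refl
  colourByResidue-mirror 2 4 _ _ () _
  colourByResidue-mirror 3 0 _ _ () _
  colourByResidue-mirror 3 1 _ _ () _
  colourByResidue-mirror 3 2 _ _ _  _ = refl
  colourByResidue-mirror 3 3 _ _ () _
  colourByResidue-mirror 3 4 _ _ () _
  colourByResidue-mirror 4 0 _ _ () _
  colourByResidue-mirror 4 1 _ _ _  _ = refl
  colourByResidue-mirror 4 2 _ _ () _
  colourByResidue-mirror 4 3 _ _ () _
  colourByResidue-mirror 4 4 _ _ () _
  colourByResidue-mirror (suc (suc (suc (suc (suc _))))) _ (s≤s (s≤s (s≤s (s≤s (s≤s ()))))) _ _ _
  colourByResidue-mirror _ (suc (suc (suc (suc (suc _))))) _ (s≤s (s≤s (s≤s (s≤s (s≤s ()))))) _ _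

  blowUp : Coloring (2 + r) → Coloring (2 + r)
  blowUp χ x = colourByResidue (x % 5) (χ (x / 5))

  blowUp-GallaiSchur : ∀ {n χ} → IsGallaiSchur n χ → (∀ x → InRange n x → Fresh (χ x)) →
                       IsGallaiSchur (4 + n * 5) (blowUp χ)
  blowUp-GallaiSchur {n} {χ} gs fresh x y _ (x∈ , y∈ , z∈ , x≤y , refl , mr) =
    colourByResidue-¬MonoOrRainbow (x % 5) (y % 5) ((x + y) % 5) (m%n<n x 5) (m%n<n y 5)
      (%-distribˡ-+ x y 5) (freshAt x∈) (freshAt y∈) (freshAt z∈) quotients-¬MonoOrRainbow mr
    where
    freshAt : ∀ {w} → InRange (4 + n * 5) w → w % 5 ≡ 0 → Fresh (χ (w / 5))
    freshAt w∈ w%5≡0 = fresh _ (∣⇒/-inRange (m%n≡0⇒n∣m _ 5 w%5≡0) w∈)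

    quotients-¬MonoOrRainbow : x % 5 ≡ 0 → y % 5 ≡ 0 →
                               ¬ MonoOrRainbow (χ (x / 5)) (χ (y / 5)) (χ ((x + y) / 5))
    quotients-¬MonoOrRainbow x%5≡0 y%5≡0 mr′ = gs (x / 5) (y / 5) ((x + y) / 5)
      ( ∣⇒/-inRange 5∣x x∈ , ∣⇒/-inRange 5∣y y∈ , ∣⇒/-inRange (∣m∣n⇒∣m+n 5∣x 5∣y) z∈
      , /-monoˡ-≤ 5 x≤y , sym (+-distrib-/-∣ˡ y 5∣x) , mr′ )
      where
      5∣x = m%n≡0⇒n∣m x 5 x%5≡0
      5∣y = m%n≡0⇒n∣m y 5 y%5≡0

  blowUp-palindromic : ∀ {n χ} → IsPalindromic n χ → IsPalindromic (4 + n * 5) (blowUp χ)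
  blowUp-palindromic {n} {χ} pal i i∈@(_ , i≤) =
    colourByResidue-mirror (i % 5) (j % 5) (m%n<n i 5) (m%n<n j 5) residues-cancel same-quotient-colour
    where
    j : ℕ
    j = suc n * 5 ∸ i

    i+j≡ : i + j ≡ suc n * 5
    i+j≡ = m+[n∸m]≡n (≤-trans i≤ (n≤1+n _))

    residues-cancel : (i % 5 + j % 5) % 5 ≡ 0
    residues-cancel = trans (sym (%-distribˡ-+ i j 5)) (n∣m⇒m%n≡0 _ 5 (subst (5 ∣_) (sym i+j≡) (n∣m*n (suc n))))

    same-quotient-colour : i % 5 ≡ 0 → χ (i / 5) ≡ χ (j / 5)
    same-quotient-colour i%5≡0 = trans (pal (i / 5) (∣⇒/-inRange 5∣i i∈)) (cong χ (sym j/5≡))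
      where
      5∣i = m%n≡0⇒n∣m i 5 i%5≡0
      j/5≡ : j / 5 ≡ suc n ∸ i / 5
      j/5≡ = begin
        j / 5                    ≡⟨ m+n∸m≡n (i / 5) (j / 5) ⟨
        i / 5 + j / 5 ∸ i / 5    ≡⟨ cong (_∸ i / 5) (+-distrib-/-∣ˡ j 5∣i) ⟨
        (i + j) / 5 ∸ i / 5      ≡⟨ cong (λ t → t / 5 ∸ i / 5) i+j≡ ⟩
        suc n * 5 / 5 ∸ i / 5    ≡⟨ cong (_∸ i / 5) (m*n/n≡m (suc n) 5) ⟩
        suc n ∸ i / 5            ∎
        where open ≡-Reasoning

open BlowUp using (blowUp; blowUp-GallaiSchur; blowUp-palindromic)

blowUp-step : ∀ {r n} → PalindromicGallaiSchur r n → PalindromicGallaiSchur (2 + r) (4 + n * 5)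
blowUp-step (χ , gs , pal) =
  blowUp ((2 ↑ʳ_) ∘ χ) ,
  blowUp-GallaiSchur (IsGallaiSchur-injective (↑ʳ-injective 2 _ _) gs) (λ _ _ → (λ ()) , (λ ())) ,
  blowUp-palindromic (λ i i∈ → cong (2 ↑ʳ_) (pal i i∈))

¬InRange0 : ∀ {x} → ¬ InRange 0 x
¬InRange0 (s≤s _ , ())

-- The blow-up of the empty colouring of [1,0]; the constant inner colouring is never consulted.
palindromicGallaiSchur-2-4 : PalindromicGallaiSchur 2 4
palindromicGallaiSchur-2-4 =
  blowUp (const zero) ,
  blowUp-GallaiSchur {χ = const zero} (λ _ _ _ → ¬InRange0 ∘ proj₁) (λ _ → ⊥-elim ∘ ¬InRange0) ,
  blowUp-palindromic {χ = const zero} (λ _ → ⊥-elim ∘ ¬InRange0)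

palindromicGallaiSchur-1-1 : PalindromicGallaiSchur 1 1
palindromicGallaiSchur-1-1 = const zero , no-triple , λ _ _ → refl
  where
  no-triple : IsGallaiSchur 1 (const zero)
  no-triple (suc x) (suc y) _ (_ , _ , (_ , s≤s x+y≤0) , _ , refl , _) with () ← subst (_≤ 0) (+-suc x y) x+y≤0

4+[p∸1]*5≡p*5∸1 : ∀ p .{{_ : NonZero p}} → 4 + (p ∸ 1) * 5 ≡ p * 5 ∸ 1
4+[p∸1]*5≡p*5∸1 (suc _) = refl

blowUp-iterate : ∀ k {r n} → PalindromicGallaiSchur r n → PalindromicGallaiSchur (2 * k + r) (suc n * 5 ^ k ∸ 1)
blowUp-iterate zero {r} {n} P = subst (PalindromicGallaiSchur r) (cong (_∸ 1) (sym (*-identityʳ (suc n)))) P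
blowUp-iterate (suc k) {r} {n} P =
  subst₂ PalindromicGallaiSchur (cong (_+ r) (sym (*-suc 2 k))) bound (blowUp-step (blowUp-iterate k P))
  where
  p = suc n * 5 ^ k
  bound : 4 + (p ∸ 1) * 5 ≡ suc n * 5 ^ suc k ∸ 1
  bound = begin
    4 + (p ∸ 1) * 5            ≡⟨ 4+[p∸1]*5≡p*5∸1 p {{m*n≢0 (suc n) (5 ^ k) {{_}} {{m^n≢0 5 k}}}} ⟩
    suc n * 5 ^ k * 5 ∸ 1      ≡⟨ cong (_∸ 1) (*-assoc (suc n) (5 ^ k) 5) ⟩
    suc n * (5 ^ k * 5) ∸ 1    ≡⟨ cong (λ t → suc n * t ∸ 1) (*-comm (5 ^ k) 5) ⟩
    suc n * 5 ^ suc k ∸ 1      ∎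
    where open ≡-Reasoning

theorem2p3 : (k : ℕ) → 1 ≤ k →
    Σ (Coloring (2 * k)) (λ χ → IsGallaiSchur (5 ^ k ∸ 1) χ × IsPalindromic (5 ^ k ∸ 1) χ)
    × Σ (Coloring (2 * k + 1)) (λ χ → IsGallaiSchur (2 * 5 ^ k ∸ 1) χ × IsPalindromic (2 * 5 ^ k ∸ 1) χ)
theorem2p3 (suc k) _ =
  subst (λ c → PalindromicGallaiSchur c (5 ^ suc k ∸ 1)) (trans (+-comm (2 * k) 2) (sym (*-suc 2 k)))
    (blowUp-iterate k palindromicGallaiSchur-2-4) ,
  blowUp-iterate (suc k) palindromicGallaiSchur-1-1
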